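{- For every tree $T$ with $|T|\ge2$ vertices, $\beta(T)\ge\frac12\big(|T|+|\mathit{Deg}_1(T)|-|\mathit{Supp}(T)|\big)$.
   Context: $\beta(T)$ is the size of a maximum independent set of $T$. $\mathit{Deg}_1(T)$ is the set of leaves (degree-$1$ vertices) of $T$; $\mathit{Supp}(T)$ is the set of support vertices, i.e., vertices adjacent to at least one leaf. -}

module Defs where

open import Data.Nat using (ℕ; zero; suc; _+_; _*_; _≤_)
open import Data.Bool using (Bool; true; false; T)
open import Data.Fin using (Fin)
open import Data.List using (List; []; _∷_; length; filter)
open import Data.List.Relation.Unary.Unique.Propositional using (Unique)
open import Data.List.Relation.Unary.Any using (any?)
open import Data.List.Relation.Unary.All using (All)
open import Data.Fin.Subset using (Subset; _∈_; ∣_∣)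
open import Data.Vec.Functional using () renaming (Vector to FVec)
open import Data.List.Base using (allFin)
open import Data.Product using (Σ; _×_; ∃)
open import Relation.Binary.PropositionalEquality using (_≡_)
open import Relation.Nullary using (¬_; Dec)
open import Data.Bool using (T?)
open import Data.Nat using (_≟_)

record Graph (n : ℕ) : Set where
  field
    adj   : Fin n → Fin n → Bool
    sym   : ∀ u v → adj u v ≡ adj v u
    irrefl : ∀ v → adj v v ≡ false
open Graph public

Adj : ∀ {n} → Graph n → Fin n → Fin n → Set
Adj G u v = T (adj G u v)

data Walk {n} (G : Graph n) : Fin n → Fin n → Set where
  here  : ∀ {u} → Walk G u u
  step  : ∀ {u w v} → Adj G u w → Walk G w v → Walk G u v

Connected : ∀ {n} → Graph n → Set
Connected G = ∀ u v → Walk G u v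

data Chain {n} (G : Graph n) : List (Fin n) → Set where
  nil  : Chain G []
  one  : ∀ {v} → Chain G (v ∷ [])
  cons : ∀ {u w vs} → Adj G u w → Chain G (w ∷ vs) → Chain G (u ∷ w ∷ vs)

data IsCycle {n} (G : Graph n) : List (Fin n) → Set where
  cycle : ∀ v₀ v₁ ws vₖ →
          Unique (v₀ ∷ v₁ ∷ ws Data.List.++ (vₖ ∷ [])) →
          Chain G (v₀ ∷ v₁ ∷ ws Data.List.++ (vₖ ∷ [])) →
          Adj G vₖ v₀ →
          IsCycle G (v₀ ∷ v₁ ∷ ws Data.List.++ (vₖ ∷ []))

Acyclic : ∀ {n} → Graph n → Set
Acyclic G = ∀ cs → ¬ IsCycle G cs

IsTree : ∀ {n} → Graph n → Set
IsTree G = Connected G × Acyclic G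

neighbours : ∀ {n} → Graph n → Fin n → List (Fin n)
neighbours {n} G v = filter (λ u → T? (adj G v u)) (allFin n)

degree : ∀ {n} → Graph n → Fin n → ℕ
degree G v = length (neighbours G v)

IsLeaf : ∀ {n} → Graph n → Fin n → Set
IsLeaf G v = degree G v ≡ 1

isLeaf? : ∀ {n} (G : Graph n) v → Dec (IsLeaf G v)
isLeaf? G v = degree G v ≟ 1

Deg₁ : ∀ {n} → Graph n → List (Fin n)
Deg₁ {n} G = filter (isLeaf? G) (allFin n)

IsSupport : ∀ {n} → Graph n → Fin n → Set
IsSupport G v = Data.List.Relation.Unary.Any.Any (IsLeaf G) (neighbours G v)

Supp : ∀ {n} → Graph n → List (Fin n)
Supp {n} G = filter (λ v → any? (isLeaf? G) (neighbours G v)) (allFin n)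

Independent : ∀ {n} → Graph n → Subset n → Set
Independent G S = ∀ u v → u ∈ S → v ∈ S → ¬ Adj G u v

IsIndependenceNumber : ∀ {n} → Graph n → ℕ → Set
IsIndependenceNumber G k =
  (Σ (Subset _) λ S → Independent G S × ∣ S ∣ ≡ k) ×
  (∀ S → Independent G S → ∣ S ∣ ≤ k)

-- A tree is bipartite: colour each vertex by the parity of a walk to it from a fixed root;
-- two adjacent vertices of the same colour would close an odd walk, and an odd closed walk
-- contains a cycle. Call a leaf pendant if it is not a support vertex, and let M be the set
-- of vertices that are leaves exactly when they are support vertices. Counting vertex by
-- vertex, n + |Deg₁| = 2|P| + |Supp| + |M| for the set P of pendant leaves. A neighbour of a
-- pendant leaf is a support vertex but not a leaf, so P together with the larger colour class
-- of M is independent; its size is at least |P| + |M|/2.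
module Submission where

open import Defs hiding (sym)

open import Data.Bool using (Bool; true; false; T; T?; not; _∧_; _∨_; _xor_)
open import Data.Bool.Properties using (T-≡)
open import Data.Empty using (⊥; ⊥-elim)
open import Data.Fin using (Fin; zero; suc)
import Data.Fin.Properties as Fin
open import Data.Fin.Subset using (_∈_; ∣_∣)
open import Data.List using (List; []; _∷_; _++_; [_]; length; filter; tabulate; initLast; _∷ʳ′_)
import Data.List.Membership.DecPropositional as Membership
open import Data.List.Membership.Propositional using (lose)
open import Data.List.Membership.Propositional.Properties using (∈-∃++; ∈-filter⁺; ∈-allFin)
open import Data.List.Properties using (++-assoc; ++-identityʳ; length-++; length-++-comm)
open import Data.List.Relation.Unary.All.Properties using (¬Any⇒All¬)
open import Data.List.Relation.Unary.AllPairs using ([]; _∷_)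
open import Data.List.Relation.Unary.Any using (any?)
open import Data.List.Relation.Unary.Unique.Propositional using (Unique)
open import Data.Nat using (ℕ; zero; suc; _+_; _*_; _≤_; _<_; s≤s; z≤n; parity)
open import Data.Nat.Induction using (<-wellFounded)
open import Data.Nat.Properties
  using (+-0-commutativeMonoid; +-comm; +-monoʳ-≤; +-monoˡ-≤; *-monoʳ-≤; ≤-total; m<m+n; m<n+m; module ≤-Reasoning)
open import Data.Nat.Tactic.RingSolver using (solve-∀)
open import Data.Parity using (Parity; 0ℙ; 1ℙ; _⁻¹) renaming (_+_ to _+ℙ_)
open import Data.Parity.Properties as ℙ using (+-homo-+; p+p⁻¹≡1ℙ)
open import Data.Product using (∃; _×_; _,_; proj₂)
open import Data.Sum using (_⊎_; inj₁; inj₂; [_,_]′)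
open import Data.Unit using (⊤; tt)
import Data.Vec as Vec
open import Data.Vec.Properties using ([]=⇒lookup; lookup⇒[]=; lookup∘tabulate)
open import Function using (_∘_; id; Equivalence)
open import Induction.WellFounded using (Acc; acc)
open import Relation.Binary.Definitions using (DecidableEquality)
open import Relation.Binary.PropositionalEquality
  using (_≡_; _≢_; refl; sym; trans; cong; subst; module ≡-Reasoning)
open import Relation.Nullary using (¬_; yes; no)
open import Relation.Nullary.Decidable using (⌊_⌋; toWitness; fromWitness)
open import Relation.Unary using (Pred; Decidable)

open import Algebra.Properties.CommutativeMonoid.Sum +-0-commutativeMonoid
  using (sum-syntax; ∑-distrib-+; sum-cong-≗)

data Repeated {a} {A : Set a} : List A → Set a where
  repeated : ∀ as y bs cs → Repeated (as ++ y ∷ bs ++ y ∷ cs)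

unique⊎repeated : ∀ {a} {A : Set a} → DecidableEquality A → (xs : List A) → Unique xs ⊎ Repeated xs
unique⊎repeated _≟_ [] = inj₁ []
unique⊎repeated _≟_ (x ∷ xs) with Membership._∈?_ _≟_ x xs
... | yes x∈xs with ∈-∃++ x∈xs
...   | bs , cs , refl = inj₂ (repeated [] x bs cs)
unique⊎repeated _≟_ (x ∷ xs) | no x∉xs with unique⊎repeated _≟_ xs
... | inj₁ u = inj₁ (¬Any⇒All¬ xs x∉xs ∷ u)
... | inj₂ (repeated as y bs cs) = inj₂ (repeated (x ∷ as) y bs cs)

length-rotate-split : ∀ {a} {A : Set a} (as : List A) y bs cs →
  length (as ++ y ∷ bs ++ y ∷ cs) ≡ length (y ∷ bs) + length (y ∷ cs ++ as)
length-rotate-split as y bs cs = begin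
  length (as ++ y ∷ bs ++ y ∷ cs)          ≡⟨ length-++-comm as (y ∷ bs ++ y ∷ cs) ⟩
  length ((y ∷ bs ++ y ∷ cs) ++ as)        ≡⟨ cong length (++-assoc (y ∷ bs) (y ∷ cs) as) ⟩
  length (y ∷ bs ++ y ∷ cs ++ as)          ≡⟨ length-++ (y ∷ bs) ⟩
  length (y ∷ bs) + length (y ∷ cs ++ as)  ∎
  where open ≡-Reasoning

parity-+-odd : ∀ m n → parity (m + n) ≡ 1ℙ → parity m ≡ 1ℙ ⊎ parity n ≡ 1ℙ
parity-+-odd m n odd rewrite +-homo-+ m n with parity m
... | 1ℙ = inj₁ refl
... | 0ℙ = inj₂ odd

parity-+-suc : ∀ m n → parity m ≡ parity n → parity (m + suc n) ≡ 1ℙ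
parity-+-suc m n m≡n = begin
  parity (m + (1 + n))             ≡⟨ +-homo-+ m (1 + n) ⟩
  parity m +ℙ parity (1 + n)       ≡⟨ cong (λ p → parity m +ℙ p) (+-homo-+ 1 n) ⟩
  parity m +ℙ parity n ⁻¹          ≡⟨ cong (λ p → parity m +ℙ p ⁻¹) (sym m≡n) ⟩
  parity m +ℙ parity m ⁻¹          ≡⟨ p+p⁻¹≡1ℙ (parity m) ⟩
  1ℙ                               ∎
  where open ≡-Reasoning

module _ {n : ℕ} (G : Graph n) where

  Adj-sym : ∀ {u v} → Adj G u v → Adj G v u
  Adj-sym {u} {v} = subst T (Graph.sym G u v)

  Adj-irrefl : ∀ {v} → ¬ Adj G v v
  Adj-irrefl {v} = subst T (irrefl G v)

  chain-++⁻ : ∀ xs {y} ys → Chain G (xs ++ y ∷ ys) → Chain G (xs ++ [ y ]) × Chain G (y ∷ ys)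
  chain-++⁻ []           ys c          = one , c
  chain-++⁻ (x ∷ [])     ys (cons a c) = cons a one , c
  chain-++⁻ (x ∷ x′ ∷ xs) ys (cons a c) with chain-++⁻ (x′ ∷ xs) ys c
  ... | c₁ , c₂ = cons a c₁ , c₂

  chain-++⁺ : ∀ xs {y} ys → Chain G (xs ++ [ y ]) → Chain G (y ∷ ys) → Chain G (xs ++ y ∷ ys)
  chain-++⁺ []            ys c₁                 c₂ = c₂
  chain-++⁺ (x ∷ [])      ys (cons a one)       c₂ = cons a c₂
  chain-++⁺ (x ∷ x′ ∷ xs) ys (cons a c₁)        c₂ = cons a (chain-++⁺ (x′ ∷ xs) ys c₁ c₂)

  -- x ∷ xs stands for the closed walk x, xs, back to x, of length length (x ∷ xs).
  Closed : List (Fin n) → Set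
  Closed []       = ⊤
  Closed (x ∷ xs) = Chain G (x ∷ xs ++ [ x ])

  closed-rotate : ∀ xs ys → Closed (xs ++ ys) → Closed (ys ++ xs)
  closed-rotate []       ys c rewrite ++-identityʳ ys = c
  closed-rotate (x ∷ xs) [] c rewrite ++-identityʳ xs = c
  closed-rotate (x ∷ xs) (y ∷ ys) c
    rewrite ++-assoc xs (y ∷ ys) [ x ] with chain-++⁻ (x ∷ xs) (ys ++ [ x ]) c
  ... | c₁ , c₂ rewrite ++-assoc ys (x ∷ xs) [ y ] = chain-++⁺ (y ∷ ys) (xs ++ [ y ]) c₂ c₁

  closed-split : ∀ y bs cs → Closed (y ∷ bs ++ y ∷ cs) → Closed (y ∷ bs) × Closed (y ∷ cs)
  closed-split y bs cs c rewrite ++-assoc bs (y ∷ cs) [ y ] = chain-++⁻ (y ∷ bs) (cs ++ [ y ]) c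

  unique-closed-odd⇒cycle : ∀ xs → Unique xs → Closed xs → parity (length xs) ≡ 1ℙ → ∃ (IsCycle G)
  unique-closed-odd⇒cycle (x ∷ [])     _ (cons a one) _ = ⊥-elim (Adj-irrefl a)
  unique-closed-odd⇒cycle (x ∷ y ∷ zs) u c odd with initLast zs
  unique-closed-odd⇒cycle (x ∷ y ∷ ._) u c ()  | []
  unique-closed-odd⇒cycle (x ∷ y ∷ ._) u c odd | ws ∷ʳ′ vₖ
    rewrite ++-assoc ws [ vₖ ] [ x ] with chain-++⁻ (x ∷ y ∷ ws) [ x ] c
  ... | path , cons vₖ~x one = _ , cycle x y ws vₖ u path vₖ~x

  -- Rotated to start at a repeated vertex, a closed walk splits there into two shorter
  -- closed walks with the same total length, one of which is odd.
  closed-odd⇒cycle′ : ∀ xs → Acc _<_ (length xs) → Closed xs → parity (length xs) ≡ 1ℙ → ∃ (IsCycle G)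
  closed-odd⇒cycle′ xs (acc rec) c odd with unique⊎repeated Fin._≟_ xs
  ... | inj₁ u = unique-closed-odd⇒cycle xs u c odd
  ... | inj₂ (repeated as y bs cs)
    with closed-split y bs (cs ++ as) (subst Closed (++-assoc (y ∷ bs) (y ∷ cs) as)
                                         (closed-rotate as (y ∷ bs ++ y ∷ cs) c))
  ... | c₁ , c₂ rewrite length-rotate-split as y bs cs
    with parity-+-odd (length (y ∷ bs)) (length (y ∷ cs ++ as)) odd
  ... | inj₁ odd₁ = closed-odd⇒cycle′ (y ∷ bs) (rec (m<m+n _ (s≤s z≤n))) c₁ odd₁
  ... | inj₂ odd₂ = closed-odd⇒cycle′ (y ∷ cs ++ as) (rec (m<n+m _ (s≤s z≤n))) c₂ odd₂

  closed-odd⇒cycle : ∀ xs → Closed xs → parity (length xs) ≡ 1ℙ → ∃ (IsCycle G)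
  closed-odd⇒cycle xs = closed-odd⇒cycle′ xs (<-wellFounded (length xs))

  lengthʷ : ∀ {u v} → Walk G u v → ℕ
  lengthʷ here       = 0
  lengthʷ (step _ w) = suc (lengthʷ w)

  _++ʷ_ : ∀ {u v w} → Walk G u v → Walk G v w → Walk G u w
  here     ++ʷ q = q
  step a p ++ʷ q = step a (p ++ʷ q)

  reverseʷ : ∀ {u v} → Walk G u v → Walk G v u
  reverseʷ here       = here
  reverseʷ (step a w) = reverseʷ w ++ʷ step (Adj-sym a) here

  length-++ʷ : ∀ {u v w} (p : Walk G u v) (q : Walk G v w) → lengthʷ (p ++ʷ q) ≡ lengthʷ p + lengthʷ q
  length-++ʷ here       q = refl
  length-++ʷ (step _ p) q = cong suc (length-++ʷ p q)

  length-reverseʷ : ∀ {u v} (w : Walk G u v) → lengthʷ (reverseʷ w) ≡ lengthʷ w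
  length-reverseʷ here       = refl
  length-reverseʷ (step a w) = begin
    lengthʷ (reverseʷ w ++ʷ step (Adj-sym a) here)  ≡⟨ length-++ʷ (reverseʷ w) _ ⟩
    lengthʷ (reverseʷ w) + 1                        ≡⟨ +-comm (lengthʷ (reverseʷ w)) 1 ⟩
    suc (lengthʷ (reverseʷ w))                      ≡⟨ cong suc (length-reverseʷ w) ⟩
    suc (lengthʷ w)                                 ∎
    where open ≡-Reasoning

  vertices : ∀ {u v} → Walk G u v → List (Fin n)
  vertices here           = []
  vertices (step {u} _ w) = u ∷ vertices w

  length-vertices : ∀ {u v} (w : Walk G u v) → length (vertices w) ≡ lengthʷ w
  length-vertices here       = refl
  length-vertices (step _ w) = cong suc (length-vertices w)

  chain-vertices : ∀ {u v} (w : Walk G u v) → Chain G (vertices w ++ [ v ])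
  chain-vertices here                = one
  chain-vertices (step a here)       = cons a one
  chain-vertices (step a (step b w)) = cons a (chain-vertices (step b w))

  closed-vertices : ∀ {v} (w : Walk G v v) → Closed (vertices w)
  closed-vertices here         = tt
  closed-vertices (step a w)   = chain-vertices (step a w)

  closed-walk-odd⇒cycle : ∀ {v} (w : Walk G v v) → parity (lengthʷ w) ≡ 1ℙ → ∃ (IsCycle G)
  closed-walk-odd⇒cycle w odd =
    closed-odd⇒cycle (vertices w) (closed-vertices w) (subst (λ k → parity k ≡ 1ℙ) (sym (length-vertices w)) odd)

  Proper : ∀ {c} {C : Set c} → (Fin n → C) → Set c
  Proper colour = ∀ {u v} → Adj G u v → colour u ≢ colour v

  distance-parity : Connected G → Fin n → Fin n → Parity
  distance-parity connected r v = parity (lengthʷ (connected r v))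

  distance-parity-proper : Acyclic G → (connected : Connected G) (r : Fin n) →
                           Proper (distance-parity connected r)
  distance-parity-proper acyclic connected r {u} {v} u~v same =
    acyclic _ (proj₂ (closed-walk-odd⇒cycle closedWalk odd))
    where
    closedWalk : Walk G r r
    closedWalk = connected r u ++ʷ step u~v (reverseʷ (connected r v))
    odd : parity (lengthʷ closedWalk) ≡ 1ℙ
    odd = subst (λ k → parity k ≡ 1ℙ) (sym closedWalk-length)
                (parity-+-suc (lengthʷ (connected r u)) (lengthʷ (connected r v)) same)
      where
      closedWalk-length : lengthʷ closedWalk ≡ lengthʷ (connected r u) + suc (lengthʷ (connected r v))
      closedWalk-length = trans (length-++ʷ (connected r u) _)
                                (cong (λ k → lengthʷ (connected r u) + suc k) (length-reverseʷ (connected r v)))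

𝟙 : Bool → ℕ
𝟙 true  = 1
𝟙 false = 0

count : ∀ {n} → (Fin n → Bool) → ℕ
count {n} p = ∑[ v < n ] 𝟙 (p v)

count-true : ∀ n → count {n} (λ _ → true) ≡ n
count-true zero    = refl
count-true (suc n) = cong suc (count-true n)

count-∨-disjoint : ∀ {n} (p q : Fin n → Bool) → (∀ v → T (p v) → T (q v) → ⊥) →
                   count (λ v → p v ∨ q v) ≡ count p + count q
count-∨-disjoint p q disjoint =
  trans (sum-cong-≗ (λ v → 𝟙-∨ (p v) (q v) (disjoint v))) (∑-distrib-+ (𝟙 ∘ p) (𝟙 ∘ q))
  where
  𝟙-∨ : ∀ a b → (T a → T b → ⊥) → 𝟙 (a ∨ b) ≡ 𝟙 a + 𝟙 b
  𝟙-∨ true  true  disj = ⊥-elim (disj tt tt)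
  𝟙-∨ true  false _    = refl
  𝟙-∨ false b     _    = refl

length-filter-tabulate : ∀ {n} {p} {A : Set} {P : Pred A p} (P? : Decidable P) (f : Fin n → A) →
                         length (filter P? (tabulate f)) ≡ count (λ v → ⌊ P? (f v) ⌋)
length-filter-tabulate {zero}  P? f = refl
length-filter-tabulate {suc n} P? f with P? (f zero)
... | yes _ = cong suc (length-filter-tabulate P? (f ∘ suc))
... | no _  = length-filter-tabulate P? (f ∘ suc)

∣tabulate∣≡count : ∀ {n} (p : Fin n → Bool) → ∣ Vec.tabulate p ∣ ≡ count p
∣tabulate∣≡count {zero}  p = refl
∣tabulate∣≡count {suc n} p with p zero
... | true  = cong suc (∣tabulate∣≡count (p ∘ suc))
... | false = ∣tabulate∣≡count (p ∘ suc)

∈-tabulate⁻ : ∀ {n} (p : Fin n → Bool) {v} → v ∈ Vec.tabulate p → T (p v)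
∈-tabulate⁻ p {v} v∈p = subst T (trans (sym ([]=⇒lookup v∈p)) (lookup∘tabulate p v)) tt

∈-tabulate⁺ : ∀ {n} (p : Fin n → Bool) {v} → T (p v) → v ∈ Vec.tabulate p
∈-tabulate⁺ p {v} pv = lookup⇒[]= v _ (trans (lookup∘tabulate p v) (Equivalence.to T-≡ pv))

select : Bool → Bool → Bool → Bool
select l s q = (l ∧ not s) ∨ (not (l xor s) ∧ q)

-- Read l, s, q as the leaf, support and colour-class flags of two adjacent vertices u and v.
select-nonadjacent : ∀ lu su qu lv sv qv → (T lu → T sv) → (T lv → T su) → (T qu → T qv → ⊥) →
                     T (select lu su qu) → T (select lv sv qv) → ⊥
select-nonadjacent _     false _ true  _     _ _  v→ _   _  _  = v→ tt
select-nonadjacent true  _     _ _     false _ u→ _  _   _  _  = u→ tt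
select-nonadjacent false false _ false false _ _  _  q≁q qu qv = q≁q qu qv
select-nonadjacent true  true  _ true  true  _ _  _  q≁q qu qv = q≁q qu qv
select-nonadjacent false true  _ _     _     _ _  _  _   ()  _
select-nonadjacent _     _     _ false true  _ _  _  _   _   ()

twice-bound : ∀ {k p s m x β} → k ≡ p + p + s + m → m ≤ x + x → p + x ≤ β → k ≤ 2 * β + s
twice-bound {k} {p} {s} {m} {x} {β} refl m≤2x p+x≤β = begin
  p + p + s + m                ≤⟨ +-monoʳ-≤ (p + p + s) m≤2x ⟩
  p + p + s + (x + x)          ≡⟨ rearrange p s x ⟩
  2 * (p + x) + s              ≤⟨ +-monoˡ-≤ s (*-monoʳ-≤ 2 p+x≤β) ⟩
  2 * β + s                    ∎
  where
  open ≤-Reasoning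
  rearrange : ∀ p s x → p + p + s + (x + x) ≡ 2 * (p + x) + s
  rearrange = solve-∀

module _ {n : ℕ} (G : Graph n) where

  leaf : Fin n → Bool
  leaf v = ⌊ isLeaf? G v ⌋

  support : Fin n → Bool
  support v = ⌊ any? (isLeaf? G) (neighbours G v) ⌋

  neighbour-of-leaf-is-support : ∀ {u v} → Adj G u v → T (leaf v) → T (support u)
  neighbour-of-leaf-is-support {u} {v} u~v v-leaf =
    fromWitness (lose (∈-filter⁺ (λ w → T? (adj G u w)) (∈-allFin v) u~v) (toWitness v-leaf))

  selection : (Fin n → Bool) → Fin n → Bool
  selection q v = select (leaf v) (support v) (q v)

  selection-independent : (q : Fin n → Bool) → Independent G (Vec.tabulate q) →
                          Independent G (Vec.tabulate (selection q))
  selection-independent q q-independent u v u∈ v∈ u~v =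
    select-nonadjacent (leaf u) (support u) (q u) (leaf v) (support v) (q v)
      (neighbour-of-leaf-is-support (Adj-sym G u~v)) (neighbour-of-leaf-is-support u~v)
      (λ qu qv → q-independent u v (∈-tabulate⁺ q qu) (∈-tabulate⁺ q qv) u~v)
      (∈-tabulate⁻ _ u∈) (∈-tabulate⁻ _ v∈)

  pendant : Fin n → Bool
  pendant v = leaf v ∧ not (support v)

  leaf⇔support : Fin n → Bool
  leaf⇔support v = not (leaf v xor support v)

  length-Deg₁ : length (Deg₁ G) ≡ count leaf
  length-Deg₁ = length-filter-tabulate (isLeaf? G) id

  length-Supp : length (Supp G) ≡ count support
  length-Supp = length-filter-tabulate (λ v → any? (isLeaf? G) (neighbours G v)) id

  order+leaves : n + count leaf ≡ count pendant + count pendant + count support + count leaf⇔support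
  order+leaves = begin
    n + count leaf
      ≡⟨ cong (_+ count leaf) (sym (count-true n)) ⟩
    count {n} (λ _ → true) + count leaf
      ≡⟨ sym (∑-distrib-+ {n} (λ _ → 1) (𝟙 ∘ leaf)) ⟩
    ∑[ v < n ] (1 + 𝟙 (leaf v))
      ≡⟨ sum-cong-≗ (λ v → per-vertex (leaf v) (support v)) ⟩
    ∑[ v < n ] (𝟙 (pendant v) + 𝟙 (pendant v) + 𝟙 (support v) + 𝟙 (leaf⇔support v))
      ≡⟨ ∑-distrib-+ _ (𝟙 ∘ leaf⇔support) ⟩
    ∑[ v < n ] (𝟙 (pendant v) + 𝟙 (pendant v) + 𝟙 (support v)) + count leaf⇔support
      ≡⟨ cong (_+ count leaf⇔support) (∑-distrib-+ _ (𝟙 ∘ support)) ⟩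
    ∑[ v < n ] (𝟙 (pendant v) + 𝟙 (pendant v)) + count support + count leaf⇔support
      ≡⟨ cong (λ k → k + count support + count leaf⇔support) (∑-distrib-+ (𝟙 ∘ pendant) (𝟙 ∘ pendant)) ⟩
    count pendant + count pendant + count support + count leaf⇔support
      ∎
    where
    open ≡-Reasoning
    per-vertex : ∀ l s → 1 + 𝟙 l ≡ 𝟙 (l ∧ not s) + 𝟙 (l ∧ not s) + 𝟙 s + 𝟙 (not (l xor s))
    per-vertex true  true  = refl
    per-vertex true  false = refl
    per-vertex false true  = refl
    per-vertex false false = refl

  count-selection : (q : Fin n → Bool) →
                    count (selection q) ≡ count pendant + count (λ v → leaf⇔support v ∧ q v)
  count-selection q =
    count-∨-disjoint pendant (λ v → leaf⇔support v ∧ q v) (λ v → disjoint (leaf v) (support v) (q v))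
    where
    disjoint : ∀ l s q → T (l ∧ not s) → T (not (l xor s) ∧ q) → ⊥
    disjoint true false _ _ ()

  module _ {β : ℕ} (maximum : ∀ S → Independent G S → ∣ S ∣ ≤ β) where

    bound-from-class : (q : Fin n → Bool) → Independent G (Vec.tabulate q) →
                       count leaf⇔support ≤ count (λ v → leaf⇔support v ∧ q v) + count (λ v → leaf⇔support v ∧ q v) →
                       n + length (Deg₁ G) ≤ 2 * β + length (Supp G)
    bound-from-class q q-independent M≤2X rewrite length-Deg₁ | length-Supp =
      twice-bound {p = count pendant} {x = X} order+leaves M≤2X P+X≤β
      where
      X : ℕ
      X = count (λ v → leaf⇔support v ∧ q v)
      P+X≤β : count pendant + X ≤ β
      P+X≤β = subst (_≤ β) (trans (∣tabulate∣≡count (selection q)) (count-selection q))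
                    (maximum (Vec.tabulate (selection q)) (selection-independent q q-independent))

    bipartite-bound : (c : Fin n → Parity) → Proper G c → n + length (Deg₁ G) ≤ 2 * β + length (Supp G)
    bipartite-bound c proper =
      [ heavier 1ℙ ∘ +-monoˡ-≤ (X 1ℙ) , heavier 0ℙ ∘ +-monoʳ-≤ (X 0ℙ) ]′ (≤-total (X 0ℙ) (X 1ℙ))
      where
      colour : Parity → Fin n → Bool
      colour p v = ⌊ c v ℙ.≟ p ⌋

      X : Parity → ℕ
      X p = count (λ v → leaf⇔support v ∧ colour p v)

      split : count leaf⇔support ≡ X 0ℙ + X 1ℙ
      split = trans (sum-cong-≗ (λ v → per-vertex (leaf⇔support v) (c v)))
                    (∑-distrib-+ (λ v → 𝟙 (leaf⇔support v ∧ colour 0ℙ v)) (λ v → 𝟙 (leaf⇔support v ∧ colour 1ℙ v)))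
        where
        per-vertex : ∀ m x → 𝟙 m ≡ 𝟙 (m ∧ ⌊ x ℙ.≟ 0ℙ ⌋) + 𝟙 (m ∧ ⌊ x ℙ.≟ 1ℙ ⌋)
        per-vertex false _  = refl
        per-vertex true  0ℙ = refl
        per-vertex true  1ℙ = refl

      class-independent : ∀ p → Independent G (Vec.tabulate (colour p))
      class-independent p u v u∈ v∈ u~v =
        proper u~v (trans (toWitness (∈-tabulate⁻ (colour p) u∈)) (sym (toWitness (∈-tabulate⁻ (colour p) v∈))))

      heavier : ∀ p → X 0ℙ + X 1ℙ ≤ X p + X p → n + length (Deg₁ G) ≤ 2 * β + length (Supp G)
      heavier p ≤twice =
        bound-from-class (colour p) (class-independent p) (subst (_≤ X p + X p) (sym split) ≤twice)

-- The hypothesis 2 ≤ n only provides a root for the colouring.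
proposition1 : (n : ℕ) → 2 ≤ n → (G : Graph n) → IsTree G →
    (β : ℕ) → IsIndependenceNumber G β →
    n + length (Deg₁ G) ≤ 2 * β + length (Supp G)
proposition1 (suc _) _ G (connected , acyclic) β (_ , maximum) =
  bipartite-bound G maximum (distance-parity G connected zero) (distance-parity-proper G acyclic connected zero)
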